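{- Let $n\ge 3$ and let $\overrightarrow{C_n}$ be the directed cycle on $n$ vertices. Then $\overrightarrow{trc}(\overrightarrow{C_n})=\overrightarrow{strc}(\overrightarrow{C_n})$, and this common value equals $3$ if $n=3$, $6$ if $n=4$, and $2n$ if $n\ge 5$.
   Context: The directed cycle $\overrightarrow{C_n}$ has vertices $v_0,\dots,v_{n-1}$ and arcs $v_0v_1,\dots,v_{n-2}v_{n-1},v_{n-1}v_0$. For a strongly connected digraph $D$: a directed path is total-rainbow if its arcs and internal vertices all receive pairwise distinct colours under a total-colouring (colouring of vertices and arcs); $\overrightarrow{trc}(D)$ (resp. $\overrightarrow{strc}(D)$) is the minimum number of colours in a total-colouring such that every ordered pair $(u,v)$ of vertices is joined by a total-rainbow directed $u$–$v$ path (resp. total-rainbow shortest directed $u$–$v$ path). -}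

module Defs where

open import Data.Nat using (ℕ; suc; _+_; _∸_; _≤_)
open import Data.Sum using (_⊎_)
open import Data.Fin using (Fin; toℕ)
open import Data.List using (List; []; _∷_; _++_; map; head; last; length; take; drop)
open import Data.List.Relation.Unary.Linked using (Linked)
open import Data.List.Relation.Unary.Unique.Propositional using (Unique)
open import Data.Maybe using (just)
open import Data.Product using (_×_; Σ)
open import Relation.Binary.PropositionalEquality using (_≡_)
open import Relation.Nullary using (¬_)

record Digraph : Set₁ where
  field
    order : ℕ
    Arc   : Fin order → Fin order → Set

open Digraph public

Cycle : ℕ → Digraph
Cycle n = record { order = n
                 ; Arc = λ u v → (toℕ v ≡ suc (toℕ u)) ⊎ (suc (toℕ u) ≡ n × toℕ v ≡ 0) }

-- A total-colouring with (at most) k colours: colours on vertices and on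
-- arcs.  Arcs are coloured via a function on ordered vertex pairs; only the
-- values on actual arcs are ever used.
record TotalColouring (D : Digraph) (k : ℕ) : Set where
  field
    vcol : Fin (order D) → Fin k
    acol : Fin (order D) → Fin (order D) → Fin k

open TotalColouring public

IsPath : (D : Digraph) → Fin (order D) → Fin (order D) → List (Fin (order D)) → Set
IsPath D u v xs = Linked (Arc D) xs × Unique xs × head xs ≡ just u × last xs ≡ just v

arcCount : ∀ {A : Set} → List A → ℕ
arcCount xs = length xs ∸ 1

internal : ∀ {A : Set} → List A → List A
internal xs = drop 1 (take (length xs ∸ 1) xs)

arcColours : ∀ {D k} → TotalColouring D k → List (Fin (order D)) → List (Fin k)
arcColours c [] = []
arcColours c (x ∷ []) = []
arcColours c (x ∷ y ∷ xs) = acol c x y ∷ arcColours c (y ∷ xs)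

pathColours : ∀ {D k} → TotalColouring D k → List (Fin (order D)) → List (Fin k)
pathColours c xs = arcColours c xs ++ map (vcol c) (internal xs)

TotalRainbow : ∀ {D k} → TotalColouring D k → List (Fin (order D)) → Set
TotalRainbow c xs = Unique (pathColours c xs)

IsShortestPath : (D : Digraph) → Fin (order D) → Fin (order D) → List (Fin (order D)) → Set
IsShortestPath D u v xs =
  IsPath D u v xs × (∀ ys → IsPath D u v ys → arcCount xs ≤ arcCount ys)

TotalRainbowConnected : ∀ {D k} → TotalColouring D k → Set
TotalRainbowConnected {D} c =
  ∀ (u v : Fin (order D)) → ¬ (u ≡ v) →
    Σ (List (Fin (order D))) λ xs → IsPath D u v xs × TotalRainbow c xs

StronglyTotalRainbowConnected : ∀ {D k} → TotalColouring D k → Set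
StronglyTotalRainbowConnected {D} c =
  ∀ (u v : Fin (order D)) → ¬ (u ≡ v) →
    Σ (List (Fin (order D))) λ xs → IsShortestPath D u v xs × TotalRainbow c xs

IsMinimum : (ℕ → Set) → ℕ → Set
IsMinimum P k = P k × (∀ j → P j → k ≤ j)

trcIs : Digraph → ℕ → Set
trcIs D = IsMinimum (λ k → Σ (TotalColouring D k) TotalRainbowConnected)

strcIs : Digraph → ℕ → Set
strcIs D = IsMinimum (λ k → Σ (TotalColouring D k) StronglyTotalRainbowConnected)

cycleValue : ℕ → ℕ
cycleValue 3 = 3
cycleValue 4 = 6
cycleValue n = n + n

-- In a directed cycle the only u–v path is the forward walk from u, so every path is shortest
-- and trc = strc.  Upper bounds are explicit colourings, checked by evaluation for n = 3, 4 and
-- injective on vertices and arcs for n ≥ 5.  For the lower bound, the path from x around to its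
-- predecessor contains, as arcs or internal vertices, every element except the arc entering x,
-- the vertex x and its predecessor; so two elements lying on one such path get distinct colours.
-- Each element is missed by at most two of these n paths, so for n ≥ 5 all 2n elements get
-- distinct colours; for n = 4 the four arcs and two adjacent vertices, and for n = 3 the three
-- arcs, are pairwise on a common path.
module Submission where

open import Defs
open import Data.Nat using (ℕ; zero; suc; _+_; _∸_; _≤_; _<_; z≤n; s≤s; _≤?_; _<?_)
open import Data.Nat.Properties
open import Data.Nat.DivMod using (_mod_)
open import Data.Fin as F using (Fin; toℕ; fromℕ<; fromℕ; inject₁; splitAt; join; _↑ˡ_; _↑ʳ_)
import Data.Fin.Properties as FP
open import Data.List using (List; []; _∷_; _++_; map; head; last; length; take; lookup)
open import Data.List.Properties using (map-++; map-∘; length-++)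
open import Data.List.Relation.Unary.Linked using (Linked; []; [-]; _∷_)
open import Data.List.Relation.Unary.Unique.Propositional using (Unique)
import Data.List.Relation.Unary.Unique.Propositional.Properties as Unique
open import Data.List.Relation.Unary.AllPairs using ([]; _∷_; allPairs?)
import Data.List.Relation.Unary.All as All
open import Data.List.Relation.Unary.Any using (here; there; index; any?)
open import Data.List.Relation.Unary.Any.Properties using (lookup-index)
open import Data.List.Membership.Propositional using (_∈_; _∉_)
open import Data.List.Membership.Propositional.Properties using (∈-map⁺; ∈-map⁻; ∈-++⁺ˡ; ∈-++⁺ʳ)
open import Data.Maybe using (just)
open import Data.Maybe.Properties using (just-injective)
open import Data.Product using (_×_; Σ; _,_; ∃)
open import Data.Sum using (_⊎_; inj₁; inj₂; [_,_])
open import Data.Sum.Properties using (inj₁-injective; inj₂-injective; ≡-dec)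
open import Data.Empty using (⊥-elim)
open import Data.Unit using (tt)
open import Function using (_∘_)
open import Function.Definitions using (Injective)
open import Relation.Binary.PropositionalEquality
  using (_≡_; _≢_; refl; sym; trans; cong; cong₂; subst; subst₂; module ≡-Reasoning)
open import Relation.Nullary using (¬_; Dec; yes; no; ¬?)
open import Relation.Nullary.Decidable using (toWitness)
open import Relation.Nullary.Decidable.Core using (_→-dec_)

initial : ∀ {A : Set} → List A → List A
initial xs = take (length xs ∸ 1) xs

∈-initial : ∀ {A : Set} (xs : List A) {t y} → t ∈ xs → last xs ≡ just y → t ≢ y → t ∈ initial xs
∈-initial (a ∷ [])     (here refl) ls t≢y = ⊥-elim (t≢y (just-injective ls))
∈-initial (a ∷ b ∷ bs) (here refl) ls t≢y = here refl
∈-initial (a ∷ b ∷ bs) (there t∈) ls t≢y = there (∈-initial (b ∷ bs) t∈ ls t≢y)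

∈-internal : ∀ {A : Set} a rest {w y : A} → w ∈ a ∷ rest → last (a ∷ rest) ≡ just y →
             w ≢ a → w ≢ y → w ∈ internal (a ∷ rest)
∈-internal a rest w∈ ls w≢a w≢y with rest | ∈-initial (a ∷ rest) w∈ ls w≢y
... | []     | ()
... | r ∷ rs | here w≡a = ⊥-elim (w≢a w≡a)
... | r ∷ rs | there w∈′ = w∈′

Unique-map⇒injectiveOn : ∀ {A B : Set} (g : A → B) {xs a b} → Unique (map g xs) →
                         a ∈ xs → b ∈ xs → g a ≡ g b → a ≡ b
Unique-map⇒injectiveOn g (_ ∷ _)  (here refl) (here refl) _  = refl
Unique-map⇒injectiveOn g (px ∷ _) (here refl) (there b∈) eq = ⊥-elim (All.lookup px (∈-map⁺ g b∈) eq)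
Unique-map⇒injectiveOn g (px ∷ _) (there a∈) (here refl) eq = ⊥-elim (All.lookup px (∈-map⁺ g a∈) (sym eq))
Unique-map⇒injectiveOn g (_ ∷ u)  (there a∈) (there b∈) eq = Unique-map⇒injectiveOn g u a∈ b∈ eq

covering⇒length≥ : ∀ {n} (xs : List (Fin n)) → (∀ x → x ∈ xs) → n ≤ length xs
covering⇒length≥ xs cover = FP.injective⇒≤ position-injective
  where
  position-injective : Injective _≡_ _≡_ (λ x → index (cover x))
  position-injective {x} {y} same = begin
    x                           ≡⟨ lookup-index (cover x) ⟩
    lookup xs (index (cover x)) ≡⟨ cong (lookup xs) same ⟩
    lookup xs (index (cover y)) ≡⟨ lookup-index (cover y) ⟨
    y                           ∎
    where open ≡-Reasoning

∃∉-short : ∀ {n} (xs : List (Fin n)) → length xs < n → ∃ λ x → x ∉ xs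
∃∉-short xs short with FP.any? (λ x → ¬? (any? (x F.≟_) xs))
... | yes missing = missing
... | no none = ⊥-elim (<⇒≱ short (covering⇒length≥ xs everywhere))
  where
  everywhere : ∀ x → x ∈ xs
  everywhere x with any? (x F.≟_) xs
  ... | yes x∈ = x∈
  ... | no x∉ = ⊥-elim (none (x , x∉))

strongly⇒total : ∀ {D k} (c : TotalColouring D k) → StronglyTotalRainbowConnected c → TotalRainbowConnected c
strongly⇒total c strong u v u≢v with strong u v u≢v
... | xs , (path , _) , rainbow = xs , path , rainbow

module DirectedCycle (m : ℕ) where

  n : ℕ
  n = suc m

  Vertex : Set
  Vertex = Fin n

  C : Digraph
  C = Cycle n

  next : Vertex → Vertex
  next i with suc (toℕ i) <? n
  ... | yes i+1<n = fromℕ< i+1<n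
  ... | no _ = F.zero

  next-arc : ∀ x → Arc C x (next x)
  next-arc x with suc (toℕ x) <? n
  ... | yes x+1<n = inj₁ (FP.toℕ-fromℕ< x+1<n)
  ... | no x+1≮n = inj₂ (≤-antisym (FP.toℕ<n x) (≮⇒≥ x+1≮n) , refl)

  arc⇒next : ∀ {x y} → Arc C x y → y ≡ next x
  arc⇒next {x} {y} a with suc (toℕ x) <? n | a
  ... | yes x+1<n | inj₁ y≡x+1     = FP.toℕ-injective (trans y≡x+1 (sym (FP.toℕ-fromℕ< x+1<n)))
  ... | yes x+1<n | inj₂ (x+1≡n , _) = ⊥-elim (<-irrefl x+1≡n x+1<n)
  ... | no x+1≮n  | inj₁ y≡x+1     = ⊥-elim (x+1≮n (subst (_< n) y≡x+1 (FP.toℕ<n y)))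
  ... | no _      | inj₂ (_ , y≡0)  = FP.toℕ-injective y≡0

  prev : Vertex → Vertex
  prev F.zero    = fromℕ m
  prev (F.suc i) = inject₁ i

  prev-arc : ∀ x → Arc C (prev x) x
  prev-arc F.zero    = inj₂ (cong suc (FP.toℕ-fromℕ m) , refl)
  prev-arc (F.suc i) = inj₁ (cong suc (sym (FP.toℕ-inject₁ i)))

  next-prev : ∀ x → next (prev x) ≡ x
  next-prev x = sym (arc⇒next (prev-arc x))

  -- Arc C x y is definitionally ArcN (toℕ x) (toℕ y).
  ArcN : ℕ → ℕ → Set
  ArcN x y = (y ≡ suc x) ⊎ (suc x ≡ n × y ≡ 0)

  distℕ : ℕ → ℕ → ℕ
  distℕ x w with x ≤? w
  ... | yes _ = w ∸ x
  ... | no _  = n ∸ x + w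

  distℕ-self : ∀ x → distℕ x x ≡ 0
  distℕ-self x with x ≤? x
  ... | yes _  = n∸n≡0 x
  ... | no x≰x = ⊥-elim (x≰x ≤-refl)

  distℕ-from-0 : ∀ w → distℕ 0 w ≡ w
  distℕ-from-0 w with 0 ≤? w
  ... | yes _  = refl
  ... | no 0≰w = ⊥-elim (0≰w z≤n)

  distℕ≡0⇒≡ : ∀ {x w} → x < n → distℕ x w ≡ 0 → w ≡ x
  distℕ≡0⇒≡ {x} {w} x<n d≡0 with x ≤? w
  ... | yes x≤w = ≤-antisym (m∸n≡0⇒m≤n d≡0) x≤w
  ... | no _    = ⊥-elim (<⇒≱ x<n (m∸n≡0⇒m≤n (m+n≡0⇒m≡0 (n ∸ x) d≡0)))

  distℕ-step : ∀ {x y w} → ArcN x y → x < n → w < n → w ≢ x → suc (distℕ y w) ≡ distℕ x w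
  distℕ-step {x} {_} {w} (inj₁ refl) x<n w<n w≢x with suc x ≤? w | x ≤? w
  ... | yes x<w | yes _    = sym (+-∸-assoc 1 x<w)
  ... | yes x<w | no x≰w   = ⊥-elim (x≰w (≤-trans (n≤1+n x) x<w))
  ... | no x≮w  | yes x≤w  = ⊥-elim (w≢x (≤-antisym (≤-pred (≰⇒> x≮w)) x≤w))
  ... | no _    | no _     = cong (_+ w) (sym (+-∸-assoc 1 (≤-pred x<n)))
  distℕ-step {x} {_} {w} (inj₂ (x+1≡n , refl)) x<n w<n w≢x with x ≤? w
  ... | yes x≤w = ⊥-elim (w≢x (≤-antisym (≤-pred (subst (w <_) (sym x+1≡n) w<n)) x≤w))
  ... | no _    = trans (cong suc (distℕ-from-0 w)) (cong (_+ w) (sym n∸x≡1))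
    where
    n∸x≡1 : n ∸ x ≡ 1
    n∸x≡1 = trans (cong (_∸ x) (sym x+1≡n)) (trans (+-∸-assoc 1 (≤-refl {x})) (cong suc (n∸n≡0 x)))

  distℕ≤m : ∀ {x w} → x < n → w < n → distℕ x w ≤ m
  distℕ≤m {x} {w} x<n w<n with x ≤? w
  distℕ≤m {x} {w} x<n w<n       | yes _  = ≤-trans (m∸n≤m w x) (≤-pred w<n)
  distℕ≤m {zero} {w} x<n w<n    | no 0≰w = ⊥-elim (0≰w z≤n)
  distℕ≤m {suc x} {w} x<n w<n   | no x≰w =
    ≤-trans (+-monoʳ-≤ (m ∸ x) (≤-pred (≰⇒> x≰w)))
            (≤-reflexive (m∸n+n≡m {m} {x} (≤-pred (m≤n⇒m≤1+n (≤-pred x<n)))))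

  distℕ-back : ∀ {x y} → ArcN x y → x < n → distℕ y x ≡ m
  distℕ-back {x} (inj₁ refl) x<n with suc x ≤? x
  ... | yes x<x = ⊥-elim (<-irrefl refl x<x)
  ... | no _    = m∸n+n≡m (≤-pred x<n)
  distℕ-back {x} (inj₂ (x+1≡n , refl)) x<n = trans (distℕ-from-0 x) (suc-injective x+1≡n)

  dist : Vertex → Vertex → ℕ
  dist x w = distℕ (toℕ x) (toℕ w)

  dist-self : ∀ x → dist x x ≡ 0
  dist-self x = distℕ-self (toℕ x)

  dist≡0⇒≡ : ∀ {x w} → dist x w ≡ 0 → w ≡ x
  dist≡0⇒≡ {x} d≡0 = FP.toℕ-injective (distℕ≡0⇒≡ (FP.toℕ<n x) d≡0)

  dist-step : ∀ {x y w} → Arc C x y → w ≢ x → suc (dist y w) ≡ dist x w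
  dist-step {x} {_} {w} a w≢x =
    distℕ-step a (FP.toℕ<n x) (FP.toℕ<n w) (λ eq → w≢x (FP.toℕ-injective eq))

  dist≤m : ∀ x w → dist x w ≤ m
  dist≤m x w = distℕ≤m (FP.toℕ<n x) (FP.toℕ<n w)

  dist-back : ∀ {x y} → Arc C x y → dist y x ≡ m
  dist-back {x} a = distℕ-back a (FP.toℕ<n x)

  dist-prev : ∀ x → dist x (prev x) ≡ m
  dist-prev x = dist-back (prev-arc x)

  path-visits : ∀ x rest {z} → Linked (Arc C) (x ∷ rest) → last (x ∷ rest) ≡ just z →
                ∀ w → dist x w ≤ dist x z → w ∈ x ∷ rest
  path-visits x [] _ ls w d≤ with just-injective ls
  ... | refl = here (dist≡0⇒≡ (n≤0⇒n≡0 (subst (dist x w ≤_) (dist-self x) d≤)))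
  path-visits x (y ∷ rest) {z} (a ∷ l) ls w d≤ with w F.≟ x | z F.≟ x
  ... | yes w≡x | _        = here w≡x
  ... | no w≢x  | yes refl = ⊥-elim (w≢x (dist≡0⇒≡ (n≤0⇒n≡0 (subst (dist x w ≤_) (dist-self x) d≤))))
  ... | no w≢x  | no z≢x   =
    there (path-visits y rest l ls w (≤-pred (subst₂ _≤_ (sym (dist-step a w≢x)) (sym (dist-step a z≢x)) d≤)))

  dist≤path-length : ∀ x rest {z} → Linked (Arc C) (x ∷ rest) → last (x ∷ rest) ≡ just z →
                     dist x z ≤ length rest
  dist≤path-length x [] _ ls with just-injective ls
  ... | refl = ≤-reflexive (dist-self x)
  dist≤path-length x (y ∷ rest) {z} (a ∷ l) ls with z F.≟ x
  ... | yes refl = ≤-trans (≤-reflexive (dist-self x)) z≤n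
  ... | no z≢x   = subst (_≤ suc (length rest)) (dist-step a z≢x) (s≤s (dist≤path-length y rest l ls))

  walk : Vertex → ℕ → List Vertex
  walk x zero    = x ∷ []
  walk x (suc k) = x ∷ walk (next x) k

  walk-linked : ∀ x k → Linked (Arc C) (walk x k)
  walk-linked x zero          = [-]
  walk-linked x (suc zero)    = next-arc x ∷ [-]
  walk-linked x (suc (suc k)) = next-arc x ∷ walk-linked (next x) (suc k)

  walk-length : ∀ x k → length (walk x k) ≡ suc k
  walk-length x zero    = refl
  walk-length x (suc k) = cong suc (walk-length (next x) k)

  walk-head : ∀ x k → head (walk x k) ≡ just x
  walk-head x zero    = refl
  walk-head x (suc k) = refl

  walk-last : ∀ x k {z} → dist x z ≡ k → last (walk x k) ≡ just z
  walk-last x zero    d≡0 = cong just (sym (dist≡0⇒≡ d≡0))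
  walk-last x (suc k) {z} d≡k+1 with z F.≟ x
  ... | yes refl = ⊥-elim (0≢1+n (trans (sym (dist-self x)) d≡k+1))
  ... | no z≢x   =
    last-cons k (walk-last (next x) k (suc-injective (trans (dist-step (next-arc x) z≢x) d≡k+1)))
    where
    last-cons : ∀ k → last (walk (next x) k) ≡ just z → last (x ∷ walk (next x) k) ≡ just z
    last-cons zero    ls = ls
    last-cons (suc k) ls = ls

  walk-within : ∀ x k {w} → w ∈ walk x k → dist x w ≤ k
  walk-within x zero    (here refl) = ≤-reflexive (dist-self x)
  walk-within x (suc k) (here refl) = ≤-trans (≤-reflexive (dist-self x)) z≤n
  walk-within x (suc k) {w} (there w∈) with w F.≟ x
  ... | yes refl = ≤-trans (≤-reflexive (dist-self x)) z≤n
  ... | no w≢x   = subst (_≤ suc k) (dist-step (next-arc x) w≢x) (s≤s (walk-within (next x) k w∈))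

  walk-unique : ∀ x k → k ≤ m → Unique (walk x k)
  walk-unique x zero    _     = All.[] ∷ []
  walk-unique x (suc k) k+1≤m = All.tabulate x∉rest ∷ walk-unique (next x) k (≤-trans (n≤1+n k) k+1≤m)
    where
    x∉rest : ∀ {w} → w ∈ walk (next x) k → x ≢ w
    x∉rest w∈ refl = <⇒≱ k+1≤m (begin
      m                ≡⟨ dist-back (next-arc x) ⟨
      dist (next x) x  ≤⟨ walk-within (next x) k w∈ ⟩
      k                ∎)
      where open ≤-Reasoning

  walk-shortest : ∀ u v → IsShortestPath C u v (walk u (dist u v))
  walk-shortest u v =
    (walk-linked u _ , walk-unique u _ (dist≤m u v) , walk-head u _ , walk-last u _ refl) , shortest
    where
    shortest : ∀ ys → IsPath C u v ys → arcCount (walk u (dist u v)) ≤ arcCount ys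
    shortest [] (_ , _ , () , _)
    shortest (y ∷ rest) (l , _ , hd , ls) with just-injective hd
    ... | refl = subst (_≤ length rest) (sym (cong (_∸ 1) (walk-length u (dist u v))))
                       (dist≤path-length u rest l ls)

  rainbow-walks? : ∀ {k} (c : TotalColouring C k) → Dec (∀ u v → TotalRainbow c (walk u (dist u v)))
  rainbow-walks? c = FP.all? λ u → FP.all? λ v →
    allPairs? (λ a b → ¬? (a F.≟ b)) (pathColours c (walk u (dist u v)))

  strongly-connected-by-walks : ∀ {k} (c : TotalColouring C k) →
    (∀ u v → TotalRainbow c (walk u (dist u v))) → StronglyTotalRainbowConnected c
  strongly-connected-by-walks c rainbow u v _ = walk u (dist u v) , walk-shortest u v , rainbow u v

  Element : Set
  Element = Vertex ⊎ Vertex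

  -- An arc is named by its tail, since the arc leaving t is t → next t.
  pattern vertex w  = inj₁ w
  pattern arcFrom t = inj₂ t

  elements : List Vertex → List Element
  elements xs = map arcFrom (initial xs) ++ map vertex (internal xs)

  elements-unique : ∀ {xs} → Unique xs → Unique (elements xs)
  elements-unique {xs} u =
    Unique.++⁺ (Unique.map⁺ inj₂-injective (Unique.take⁺ _ u))
               (Unique.map⁺ inj₁-injective (Unique.drop⁺ 1 (Unique.take⁺ (length xs ∸ 1) u)))
               arcs≠vertices
    where
    arcs≠vertices : ∀ {e} → ¬ (e ∈ map arcFrom (initial xs) × e ∈ map vertex (internal xs))
    arcs≠vertices (e∈arcs , e∈vertices) with ∈-map⁻ arcFrom e∈arcs | ∈-map⁻ vertex e∈vertices
    ... | _ , _ , refl | _ , _ , ()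

  module _ {k} (c : TotalColouring C k) where

    colour : Element → Fin k
    colour (vertex w)  = vcol c w
    colour (arcFrom t) = acol c t (next t)

    arcColours≡map-colour : ∀ xs → Linked (Arc C) xs → arcColours c xs ≡ map (colour ∘ arcFrom) (initial xs)
    arcColours≡map-colour []           _       = refl
    arcColours≡map-colour (x ∷ [])     _       = refl
    arcColours≡map-colour (x ∷ y ∷ xs) (a ∷ l) =
      cong₂ _∷_ (cong (acol c x) (arc⇒next a)) (arcColours≡map-colour (y ∷ xs) l)

    pathColours≡map-colour : ∀ xs → Linked (Arc C) xs → pathColours c xs ≡ map colour (elements xs)
    pathColours≡map-colour xs l = begin
      arcColours c xs ++ map (vcol c) (internal xs)
        ≡⟨ cong (_++ map (vcol c) (internal xs)) (arcColours≡map-colour xs l) ⟩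
      map (colour ∘ arcFrom) (initial xs) ++ map (colour ∘ vertex) (internal xs)
        ≡⟨ cong₂ _++_ (map-∘ (initial xs)) (map-∘ (internal xs)) ⟩
      map colour (map arcFrom (initial xs)) ++ map colour (map vertex (internal xs))
        ≡⟨ map-++ colour (map arcFrom (initial xs)) (map vertex (internal xs)) ⟨
      map colour (elements xs) ∎
      where open ≡-Reasoning

    rainbow-if-colour-injective : Injective _≡_ _≡_ colour → ∀ {xs} → Linked (Arc C) xs → Unique xs →
                                  TotalRainbow c xs
    rainbow-if-colour-injective inj {xs} l u =
      subst Unique (sym (pathColours≡map-colour xs l)) (Unique.map⁺ inj (elements-unique u))

  -- The vertices x for which e is neither an arc nor an internal vertex of the path from x to prev x.
  misses : Element → List Vertex
  misses (vertex w)  = w ∷ next w ∷ []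
  misses (arcFrom t) = next t ∷ []

  avoid-misses : 4 < n → ∀ e e′ → ∃ λ x → x ∉ misses e ++ misses e′
  avoid-misses 4<n e e′ = ∃∉-short (misses e ++ misses e′) (begin-strict
    length (misses e ++ misses e′)          ≡⟨ length-++ (misses e) ⟩
    length (misses e) + length (misses e′)  ≤⟨ +-mono-≤ (misses≤2 e) (misses≤2 e′) ⟩
    4                                       <⟨ 4<n ⟩
    n                                       ∎)
    where
    open ≤-Reasoning
    misses≤2 : ∀ e → length (misses e) ≤ 2
    misses≤2 (vertex _)  = ≤-refl
    misses≤2 (arcFrom _) = s≤s z≤n

  ≡prev⇒next≡ : ∀ {w x} → w ≡ prev x → x ≡ next w
  ≡prev⇒next≡ {x = x} refl = sym (next-prev x)

  around-visits : ∀ x rest → Linked (Arc C) (x ∷ rest) → last (x ∷ rest) ≡ just (prev x) →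
                  ∀ w → w ∈ x ∷ rest
  around-visits x rest l ls w =
    path-visits x rest l ls w (subst (dist x w ≤_) (sym (dist-prev x)) (dist≤m x w))

  around-contains : ∀ x rest → Linked (Arc C) (x ∷ rest) → last (x ∷ rest) ≡ just (prev x) →
                    ∀ e → x ∉ misses e → e ∈ elements (x ∷ rest)
  around-contains x rest l ls (arcFrom t) x∉ =
    ∈-++⁺ˡ (∈-map⁺ arcFrom
      (∈-initial (x ∷ rest) (around-visits x rest l ls t) ls (λ t≡prev → x∉ (here (≡prev⇒next≡ t≡prev)))))
  around-contains x rest l ls (vertex w) x∉ =
    ∈-++⁺ʳ (map arcFrom (initial (x ∷ rest))) (∈-map⁺ vertex
      (∈-internal x rest (around-visits x rest l ls w) ls
        (λ w≡x → x∉ (here (sym w≡x)))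
        (λ w≡prev → x∉ (there (here (≡prev⇒next≡ w≡prev))))))

  prev≢ : 1 ≤ m → ∀ x → x ≢ prev x
  prev≢ 1≤m x x≡prev with subst (λ y → Arc C y x) (sym x≡prev) (prev-arc x)
  ... | inj₁ x≡x+1         = <-irrefl x≡x+1 (n<1+n (toℕ x))
  ... | inj₂ (x+1≡n , x≡0) = <-irrefl (suc-injective (trans (sym (cong suc x≡0)) x+1≡n)) 1≤m

  module _ {k} {c : TotalColouring C k} (connected : TotalRainbowConnected c) (1≤m : 1 ≤ m) where

    colour-injective-around : ∀ x {e e′} → x ∉ misses e → x ∉ misses e′ → colour c e ≡ colour c e′ → e ≡ e′
    colour-injective-around x x∉ x∉′ same with connected x (prev x) (prev≢ 1≤m x)
    ... | [] , (_ , _ , () , _) , _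
    ... | (_ ∷ rest) , (l , _ , hd , ls) , rainbow with just-injective hd
    ... | refl = Unique-map⇒injectiveOn (colour c) (subst Unique (pathColours≡map-colour c _ l) rainbow)
                   (around-contains x rest l ls _ x∉) (around-contains x rest l ls _ x∉′) same

    colours-lower-bound : ∀ {ℓ} (g : Fin ℓ → Element) → Injective _≡_ _≡_ g →
                          (∀ i j → i ≢ j → ∃ λ x → x ∉ misses (g i) ++ misses (g j)) → ℓ ≤ k
    colours-lower-bound g g-injective separated = FP.injective⇒≤ colour∘g-injective
      where
      colour∘g-injective : Injective _≡_ _≡_ (colour c ∘ g)
      colour∘g-injective {i} {j} same with i F.≟ j
      ... | yes i≡j = i≡j
      ... | no i≢j with separated i j i≢j
      ... | x , x∉ = g-injective (colour-injective-around x (λ x∈ → x∉ (∈-++⁺ˡ x∈))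
                                                           (λ x∈ → x∉ (∈-++⁺ʳ (misses (g i)) x∈)) same)

bounds⇒trc-strc : ∀ {D} k → Σ (TotalColouring D k) StronglyTotalRainbowConnected →
                  (∀ j → Σ (TotalColouring D j) TotalRainbowConnected → k ≤ j) →
                  trcIs D k × strcIs D k
bounds⇒trc-strc k (c , strong) lower =
  ((c , strongly⇒total c strong) , lower) ,
  ((c , strong) , λ j (c′ , strong′) → lower j (c′ , strongly⇒total c′ strong′))

module Triangle where
  open DirectedCycle 2

  colouring : TotalColouring C 3
  colouring = record { vcol = next ; acol = λ t _ → t }

  upper : Σ (TotalColouring C 3) StronglyTotalRainbowConnected
  upper = colouring , strongly-connected-by-walks colouring (toWitness {a? = rainbow-walks? colouring} tt)

  lower : ∀ j → Σ (TotalColouring C j) TotalRainbowConnected → 3 ≤ j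
  lower j (c , connected) = colours-lower-bound connected (s≤s z≤n) arcFrom inj₂-injective
    (λ i i′ _ → ∃∉-short (misses (arcFrom i) ++ misses (arcFrom i′)) (s≤s (s≤s (s≤s z≤n))))

module Square where
  open DirectedCycle 3

  parity : Vertex → Fin 2
  parity x = toℕ x mod 2

  colouring : TotalColouring C 6
  colouring = record { vcol = λ w → 4 ↑ʳ parity w ; acol = λ t _ → t ↑ˡ 2 }

  upper : Σ (TotalColouring C 6) StronglyTotalRainbowConnected
  upper = colouring , strongly-connected-by-walks colouring (toWitness {a? = rainbow-walks? colouring} tt)

  -- the four arcs and the vertices 0 and 1
  witnesses : Fin 6 → Element
  witnesses i = [ arcFrom , (λ b → vertex (b ↑ˡ 2)) ] (splitAt 4 i)

  witnesses-injective : ∀ i j → witnesses i ≡ witnesses j → i ≡ j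
  witnesses-injective = toWitness {a? = FP.all? λ i → FP.all? λ j →
    ≡-dec F._≟_ F._≟_ (witnesses i) (witnesses j) →-dec (i F.≟ j)} tt

  witnesses-separated : ∀ i j → i ≢ j → ∃ λ x → x ∉ misses (witnesses i) ++ misses (witnesses j)
  witnesses-separated = toWitness {a? = FP.all? λ i → FP.all? λ j →
    ¬? (i F.≟ j) →-dec FP.any? (λ x → ¬? (any? (x F.≟_) (misses (witnesses i) ++ misses (witnesses j))))} tt

  lower : ∀ j → Σ (TotalColouring C j) TotalRainbowConnected → 6 ≤ j
  lower j (c , connected) =
    colours-lower-bound connected (s≤s z≤n) witnesses (witnesses-injective _ _) witnesses-separated

module Large (k : ℕ) where
  open DirectedCycle (4 + k)

  colouring : TotalColouring C (n + n)
  colouring = record { vcol = λ w → join n n (vertex w) ; acol = λ t _ → join n n (arcFrom t) }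

  colour≡join : ∀ e → colour colouring e ≡ join n n e
  colour≡join (vertex _)  = refl
  colour≡join (arcFrom _) = refl

  colour-injective : Injective _≡_ _≡_ (colour colouring)
  colour-injective {e} {e′} same = begin
    e                               ≡⟨ FP.splitAt-join n n e ⟨
    splitAt n (join n n e)          ≡⟨ cong (splitAt n) (colour≡join e) ⟨
    splitAt n (colour colouring e)  ≡⟨ cong (splitAt n) same ⟩
    splitAt n (colour colouring e′) ≡⟨ cong (splitAt n) (colour≡join e′) ⟩
    splitAt n (join n n e′)         ≡⟨ FP.splitAt-join n n e′ ⟩
    e′                              ∎
    where open ≡-Reasoning

  upper : Σ (TotalColouring C (n + n)) StronglyTotalRainbowConnected
  upper = colouring , strongly-connected-by-walks colouring λ u v →
    rainbow-if-colour-injective colouring colour-injective (walk-linked u _) (walk-unique u _ (dist≤m u v))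

  splitAt-injective : Injective _≡_ _≡_ (splitAt n {n})
  splitAt-injective {i} {j} same = begin
    i                      ≡⟨ FP.join-splitAt n n i ⟨
    join n n (splitAt n i) ≡⟨ cong (join n n) same ⟩
    join n n (splitAt n j) ≡⟨ FP.join-splitAt n n j ⟩
    j                      ∎
    where open ≡-Reasoning

  lower : ∀ j → Σ (TotalColouring C j) TotalRainbowConnected → n + n ≤ j
  lower j (c , connected) = colours-lower-bound connected (s≤s z≤n) (splitAt n) splitAt-injective
    (λ i i′ _ → avoid-misses (s≤s (s≤s (s≤s (s≤s (s≤s z≤n))))) (splitAt n i) (splitAt n i′))

theorem10 : (n : ℕ) → 3 ≤ n → trcIs (Cycle n) (cycleValue n) × strcIs (Cycle n) (cycleValue n)
theorem10 (suc zero)                      (s≤s ())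
theorem10 (suc (suc zero))                (s≤s (s≤s ()))
theorem10 (suc (suc (suc zero)))           _ = bounds⇒trc-strc 3 Triangle.upper Triangle.lower
theorem10 (suc (suc (suc (suc zero))))     _ = bounds⇒trc-strc 6 Square.upper Square.lower
theorem10 (suc (suc (suc (suc (suc k))))) _ = bounds⇒trc-strc _ (Large.upper k) (Large.lower k)
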